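{- In $\mathcal{L}\mathcal{R}$-Subtraction Nim with removable set $S=\{2,3,6\}$, for $n\in\mathbb{Z}_{\ge0}$: $\mathcal{O}_S(n)=\mathcal{L}$ if $n\in\{0,2,5,6\}$ or $n\ge 8$; $\mathcal{O}_S(n)=\mathcal{R}$ if $n=1$; $\mathcal{O}_S(n)=\mathcal{N}$ if $n\in\{3,4,7\}$.
   Context: $\mathcal{L}\mathcal{R}$-Subtraction Nim with removable set $S$ (a non-empty subset of $\mathbb{Z}_{\ge 2}$): a position is a number $n\in\mathbb{Z}_{\ge0}$ of tokens. Players Left and Right alternate moves; a move from $n$ removes $s$ tokens for some $s\in S$ with $s\le n$, leading to $n-s$. When the player to move has no move (i.e. $n<\min S$), the game ends; Left wins if the number $n$ of remaining tokens is even and Right wins if $n$ is odd (regardless of who is to move). The outcome $\mathcal{O}_S(n)$ is $\mathcal{L}$ if Left has a winning strategy from $n$ both moving first and moving second; $\mathcal{R}$ if Right has a winning strategy both moving first and moving second; $\mathcal{N}$ if the first player to move (whether Left or Right) has a winning strategy; $\mathcal{P}$ if the second player (whether Left or Right) has a winning strategy. -}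

module Defs where

open import Data.Nat using (ℕ; _≤_; _∸_)
open import Data.Nat.Divisibility using (_∣_)
open import Data.Product using (Σ; _×_; _,_)
open import Data.List using (List; _∷_; [])
open import Data.List.Membership.Propositional using (_∈_)
open import Relation.Nullary using (¬_)

Even : ℕ → Set
Even n = 2 ∣ n

Odd : ℕ → Set
Odd n = ¬ (2 ∣ n)

HasMove : List ℕ → ℕ → Set
HasMove S n = Σ ℕ (λ s → s ∈ S × s ≤ n)

Terminal : List ℕ → ℕ → Set
Terminal S n = ¬ HasMove S n

data LwinsLtoMove (S : List ℕ) (n : ℕ) : Set
data LwinsRtoMove (S : List ℕ) (n : ℕ) : Set

data LwinsLtoMove S n where
  l-end  : Terminal S n → Even n → LwinsLtoMove S n
  l-move : (s : ℕ) → s ∈ S → s ≤ n → LwinsRtoMove S (n ∸ s) → LwinsLtoMove S n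

data LwinsRtoMove S n where
  r-end  : Terminal S n → Even n → LwinsRtoMove S n
  r-all  : HasMove S n →
           ((s : ℕ) → s ∈ S → s ≤ n → LwinsLtoMove S (n ∸ s)) → LwinsRtoMove S n

data RwinsRtoMove (S : List ℕ) (n : ℕ) : Set
data RwinsLtoMove (S : List ℕ) (n : ℕ) : Set

data RwinsRtoMove S n where
  r-end  : Terminal S n → Odd n → RwinsRtoMove S n
  r-move : (s : ℕ) → s ∈ S → s ≤ n → RwinsLtoMove S (n ∸ s) → RwinsRtoMove S n

data RwinsLtoMove S n where
  l-end  : Terminal S n → Odd n → RwinsLtoMove S n
  l-all  : HasMove S n →
           ((s : ℕ) → s ∈ S → s ≤ n → RwinsRtoMove S (n ∸ s)) → RwinsLtoMove S n

data Outcome : Set where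
  𝓛 𝓡 𝓝 𝓟 : Outcome

data HasOutcome (S : List ℕ) (n : ℕ) : Outcome → Set where
  isL : LwinsLtoMove S n → LwinsRtoMove S n → HasOutcome S n 𝓛
  isR : RwinsRtoMove S n → RwinsLtoMove S n → HasOutcome S n 𝓡
  isN : LwinsLtoMove S n → RwinsRtoMove S n → HasOutcome S n 𝓝
  isP : RwinsLtoMove S n → LwinsRtoMove S n → HasOutcome S n 𝓟

S236 : List ℕ
S236 = 2 ∷ 3 ∷ 6 ∷ []

-- Left wins moving first from every n ≥ 2: she can always move to one of the positions
-- 0, 2, 5, 6 or n ≥ 8, and from each of these every move of Right lands on 0 or on a position
-- ≥ 2, where Left again wins moving first.  Position 1 is terminal and odd, so it is Right's,
-- and Right wins moving first from 3, 4 and 7 by removing 2, 3 or 6 tokens to reach 1.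
module Submission where

open import Defs
open import Data.Nat using (ℕ; _≤_; _<_; _+_; _∸_; suc; z≤n; s≤s)
open import Data.Nat.Properties using (≤-refl; ≤-trans; <⇒≱; m≤m+n; m+n∸m≡n; m≤n⇒∃[o]m+o≡n)
open import Data.Nat.Divisibility using (_∣0; ∣1⇒≡1)
open import Data.List.Membership.Propositional using (_∈_)
open import Data.List.Relation.Unary.All as All using (All; []; _∷_)
open import Data.List.Relation.Unary.Any using (here; there)
open import Data.Product using (_×_; _,_)
open import Data.Sum using (_⊎_; inj₁; inj₂)
open import Relation.Binary.PropositionalEquality using (_≡_; refl; sym; subst)

even-0 : Even 0
even-0 = 2 ∣0

odd-1 : Odd 1
odd-1 2∣1 with () ← ∣1⇒≡1 2∣1

terminal-below-min : ∀ {S m n} → All (m ≤_) S → n < m → Terminal S n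
terminal-below-min S≥m n<m (s , s∈S , s≤n) =
  <⇒≱ n<m (≤-trans (All.lookup S≥m s∈S) s≤n)

left-moves-to : ∀ {S s n} → s ∈ S → LwinsRtoMove S n → LwinsLtoMove S (s + n)
left-moves-to {S} {s} {n} s∈S win =
  l-move s s∈S (m≤m+n s n) (subst (LwinsRtoMove S) (sym (m+n∸m≡n s n)) win)

right-moves-to : ∀ {S s n} → s ∈ S → RwinsLtoMove S n → RwinsRtoMove S (s + n)
right-moves-to {S} {s} {n} s∈S win =
  r-move s s∈S (m≤m+n s n) (subst (RwinsLtoMove S) (sym (m+n∸m≡n s n)) win)

left-answers-all : ∀ {S n} → HasMove S n →
  All (λ s → s ≤ n → LwinsLtoMove S (n ∸ s)) S → LwinsRtoMove S n
left-answers-all move answers = r-all move (λ _ s∈S → All.lookup answers s∈S)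

2∈S236 : 2 ∈ S236
2∈S236 = here refl

3∈S236 : 3 ∈ S236
3∈S236 = there (here refl)

6∈S236 : 6 ∈ S236
6∈S236 = there (there (here refl))

S236-≥2 : All (2 ≤_) S236
S236-≥2 = m≤m+n 2 0 ∷ m≤m+n 2 1 ∷ m≤m+n 2 4 ∷ []

terminal-S236 : ∀ {n} → n < 2 → Terminal S236 n
terminal-S236 = terminal-below-min S236-≥2

move-2-from : ∀ k → HasMove S236 (2 + k)
move-2-from k = 2 , 2∈S236 , m≤m+n 2 k

left-first-0 : LwinsLtoMove S236 0
left-first-0 = l-end (terminal-S236 (s≤s z≤n)) even-0

left-second-0 : LwinsRtoMove S236 0
left-second-0 = r-end (terminal-S236 (s≤s z≤n)) even-0

left-second-≥8 : ∀ k → LwinsLtoMove S236 (6 + k) → LwinsLtoMove S236 (5 + k) →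
  LwinsLtoMove S236 (2 + k) → LwinsRtoMove S236 (8 + k)
left-second-≥8 k after-2 after-3 after-6 =
  left-answers-all (move-2-from (6 + k)) ((λ _ → after-2) ∷ (λ _ → after-3) ∷ (λ _ → after-6) ∷ [])

mutual
  left-first-≥2 : ∀ k → LwinsLtoMove S236 (2 + k)
  left-first-≥2 0 = left-moves-to 2∈S236 left-second-0
  left-first-≥2 1 = left-moves-to 3∈S236 left-second-0
  left-first-≥2 2 = left-moves-to 2∈S236 left-second-2
  left-first-≥2 3 = left-moves-to 3∈S236 left-second-2
  left-first-≥2 4 = left-moves-to 6∈S236 left-second-0
  left-first-≥2 5 = left-moves-to 2∈S236 left-second-5
  left-first-≥2 6 = left-moves-to 6∈S236 left-second-2
  left-first-≥2 7 = left-moves-to 3∈S236 left-second-6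
  left-first-≥2 (suc (suc (suc (suc k₄@(suc k₃@(suc (suc (suc k)))))))) =
    left-moves-to 2∈S236
      (left-second-≥8 k (left-first-≥2 k₄) (left-first-≥2 k₃) (left-first-≥2 k))

  left-second-2 : LwinsRtoMove S236 2
  left-second-2 = left-answers-all (move-2-from 0)
    ((λ _ → left-first-0) ∷ (λ { (s≤s (s≤s ())) }) ∷ (λ { (s≤s (s≤s ())) }) ∷ [])

  left-second-5 : LwinsRtoMove S236 5
  left-second-5 = left-answers-all (move-2-from 3)
    ((λ _ → left-first-≥2 1) ∷ (λ _ → left-first-≥2 0) ∷ (λ { (s≤s (s≤s (s≤s (s≤s (s≤s ()))))) }) ∷ [])

  left-second-6 : LwinsRtoMove S236 6
  left-second-6 = left-answers-all (move-2-from 4)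
    ((λ _ → left-first-≥2 2) ∷ (λ _ → left-first-≥2 1) ∷ (λ _ → left-first-0) ∷ [])

right-first-1 : RwinsRtoMove S236 1
right-first-1 = r-end (terminal-S236 ≤-refl) odd-1

right-second-1 : RwinsLtoMove S236 1
right-second-1 = l-end (terminal-S236 ≤-refl) odd-1

proposition4 : (n : ℕ) →
    ((n ≡ 0 ⊎ n ≡ 2 ⊎ n ≡ 5 ⊎ n ≡ 6 ⊎ 8 ≤ n) → HasOutcome S236 n 𝓛) ×
    (n ≡ 1 → HasOutcome S236 n 𝓡) ×
    ((n ≡ 3 ⊎ n ≡ 4 ⊎ n ≡ 7) → HasOutcome S236 n 𝓝)
proposition4 n = left-wins n , right-wins n , first-player-wins n
  where
  left-wins : ∀ n → (n ≡ 0 ⊎ n ≡ 2 ⊎ n ≡ 5 ⊎ n ≡ 6 ⊎ 8 ≤ n) → HasOutcome S236 n 𝓛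
  left-wins _ (inj₁ refl) = isL left-first-0 left-second-0
  left-wins _ (inj₂ (inj₁ refl)) = isL (left-first-≥2 0) left-second-2
  left-wins _ (inj₂ (inj₂ (inj₁ refl))) = isL (left-first-≥2 3) left-second-5
  left-wins _ (inj₂ (inj₂ (inj₂ (inj₁ refl)))) = isL (left-first-≥2 4) left-second-6
  left-wins _ (inj₂ (inj₂ (inj₂ (inj₂ 8≤n)))) with k , refl ← m≤n⇒∃[o]m+o≡n 8≤n =
    isL (left-first-≥2 (6 + k))
        (left-second-≥8 k (left-first-≥2 (4 + k)) (left-first-≥2 (3 + k)) (left-first-≥2 k))

  right-wins : ∀ n → n ≡ 1 → HasOutcome S236 n 𝓡
  right-wins _ refl = isR right-first-1 right-second-1

  first-player-wins : ∀ n → (n ≡ 3 ⊎ n ≡ 4 ⊎ n ≡ 7) → HasOutcome S236 n 𝓝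
  first-player-wins _ (inj₁ refl) = isN (left-first-≥2 1) (right-moves-to 2∈S236 right-second-1)
  first-player-wins _ (inj₂ (inj₁ refl)) = isN (left-first-≥2 2) (right-moves-to 3∈S236 right-second-1)
  first-player-wins _ (inj₂ (inj₂ refl)) = isN (left-first-≥2 5) (right-moves-to 6∈S236 right-second-1)
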